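{- There exists a family of graphs $\{G_k\}_{k\in\mathbb{Z}^+}$ with $\operatorname{bdim}(G_k)=\Theta(k)$ and $\operatorname{adim}(G_k)=2^{\Omega(k)}$ for every $k\in\mathbb{Z}^+$.
   Context: All graphs are finite, simple and undirected. $d(u,v)$ is graph distance and $d_k(u,v)=\min\{d(u,v),k+1\}$. A function $f:V(G)\to\mathbb{Z}_{\ge0}$ is a resolving broadcast if for any distinct $x,y$ there is $z$ with $f(z)>0$ and $d_{f(z)}(x,z)\ne d_{f(z)}(y,z)$; $\operatorname{bdim}(G)$ is the minimum of $\sum_v f(v)$ over resolving broadcasts. A set $A\subseteq V(G)$ is an adjacency resolving set if for any distinct $x,y$ there is $z\in A$ with $d_1(x,z)\ne d_1(y,z)$; $\operatorname{adim}(G)$ is the minimum size of such a set. -}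

module Defs where

open import Data.Nat using (ℕ; zero; suc; _+_; _*_; _^_; _≤_; _<_)
open import Data.Bool using (Bool; true; false; if_then_else_; _∧_; _∨_)
open import Data.Fin using (Fin; _≟_)
open import Data.Fin.Subset using (Subset; _∈_; ∣_∣)
open import Data.Vec.Functional using (foldr)
open import Data.List using (List; allFin; map)
open import Data.Bool.ListAction using (any)
open import Data.Nat.ListAction using (sum)
open import Data.Product using (Σ; _×_; ∃)
open import Relation.Nullary using (¬_; does)
open import Relation.Binary.PropositionalEquality using (_≡_; _≢_)

record Graph : Set where
  field
    n       : ℕ
    adj     : Fin n → Fin n → Bool
    sym     : ∀ u v → adj u v ≡ adj v u
    irrefl  : ∀ u → adj u u ≡ false
open Graph public

reach : (G : Graph) → ℕ → Fin (n G) → Fin (n G) → Bool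
reach G zero    x z = does (x ≟ z)
reach G (suc j) x z = reach G j x z ∨ any (λ w → reach G j x w ∧ adj G w z) (allFin (n G))

-- least j ∈ {0..m} with p j = true, and m+1 if there is none
minUpTo : (ℕ → Bool) → ℕ → ℕ
minUpTo p zero    = if p 0 then 0 else 1
minUpTo p (suc m) = if p 0 then 0 else suc (minUpTo (λ j → p (suc j)) m)

-- truncated distance d_k(x,z) = min{d(x,z), k+1}  (d = ∞ if disconnected)
dk : (G : Graph) → ℕ → Fin (n G) → Fin (n G) → ℕ
dk G k x z = minUpTo (λ j → reach G j x z) k

IsResolvingBroadcast : (G : Graph) → (Fin (n G) → ℕ) → Set
IsResolvingBroadcast G f =
  ∀ (x y : Fin (n G)) → x ≢ y →
    ∃ λ (z : Fin (n G)) → (0 < f z) × (dk G (f z) x z ≢ dk G (f z) y z)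

cost : (G : Graph) → (Fin (n G) → ℕ) → ℕ
cost G f = sum (map f (allFin (n G)))

IsBdim : Graph → ℕ → Set
IsBdim G b =
  (∃ λ (f : Fin (n G) → ℕ) → IsResolvingBroadcast G f × cost G f ≡ b)
  × (∀ (f : Fin (n G) → ℕ) → IsResolvingBroadcast G f → b ≤ cost G f)

IsAdjResolvingSet : (G : Graph) → Subset (n G) → Set
IsAdjResolvingSet G A =
  ∀ (x y : Fin (n G)) → x ≢ y →
    ∃ λ (z : Fin (n G)) → (z ∈ A) × (dk G 1 x z ≢ dk G 1 y z)

IsAdim : Graph → ℕ → Set
IsAdim G a =
  (∃ λ (A : Subset (n G)) → IsAdjResolvingSet G A × ∣ A ∣ ≡ a)
  × (∀ (A : Subset (n G)) → IsAdjResolvingSet G A → a ≤ ∣ A ∣)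

-- G_k has twin pairs P i, Q i hanging off M i (i < k), a hub R, a vertex S u for every
-- u ∈ {0,1}^k joined to R and to the M i with uᵢ = 1, and a pendant leaf L u on each S u.
-- Twins are separated only by themselves, so every resolving broadcast and every
-- adjacency resolving set meets each pair {P i, Q i}: bdim ≥ k. Conversely value 1 on every
-- P i and on R and value 2 on every M i resolves (M i reaches L u in two steps iff uᵢ = 1),
-- so bdim ≤ 3k + 1. At range 1, two leaves L u, L t are separated only by L u, S u, L t or
-- S t, so an adjacency resolving set meets all but at most one of the 2^k pairs {L u, S u},
-- and with one twin adim ≥ 2^k. Both parameters exist since a least-cost resolving
-- broadcast and a smallest adjacency resolving set can be found by finite search.

module Submission where

open import Defs hiding (sym)
open import Data.Nat using (ℕ; zero; suc; _+_; _*_; _∸_; _^_; _≤_; _<_; z≤n; s≤s; _≟_; _<?_)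
open import Data.Nat.Properties
open import Data.Nat.Tactic.RingSolver using (solve-∀)
open import Data.Bool using (Bool; true; false; _∧_; _∨_; if_then_else_)
open import Data.Bool.Properties using (T-≡; ⇔→≡; ∨-comm; ∨-identityʳ; ∧-conicalˡ; ∧-conicalʳ; ¬-not)
open import Data.Fin using (Fin; zero; suc; toℕ; fromℕ<; _↑ˡ_; _↑ʳ_; combine; funToFin; finToFun)
open import Data.Fin.Properties using (2↔Bool; +↔⊎; ¬∀⟶∃¬; funToFin-finToFin)
import Data.Fin.Properties as Fin
open import Data.List using (allFin; tabulate)
open import Data.List.Properties using (map-tabulate; map-cong)
open import Data.List.Membership.Propositional using (lose)
open import Data.List.Membership.Propositional.Properties using (∈-allFin)
open import Data.List.Relation.Unary.Any using (satisfied)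
open import Data.List.Relation.Unary.Any.Properties using (any⁺; any⁻)
open import Data.Bool.ListAction using (any; or)
open import Data.Nat.ListAction using (sum)
open import Algebra.Properties.CommutativeMonoid.Sum +-0-commutativeMonoid using (sum-syntax; sum-cong-≗; ∑-distrib-+)
  renaming (sum to ∑)
open import Data.Fin.Subset using (Subset; _∈_; ∣_∣; ⊤)
open import Data.Fin.Subset.Properties using (_∈?_; ∈⊤; anySubset?)
open import Data.Vec.Functional using (_∷_; tail)
open import Data.Vec using ([]; lookup) renaming (_∷_ to _∷ᵛ_)
open import Data.Vec.Properties using ([]=⇒lookup)
open import Data.Product using (_×_; ∃; _,_)
open import Data.Sum using (_⊎_; inj₁; inj₂; map₂; [_,_]′)
open import Data.Empty using (⊥; ⊥-elim)
open import Function using (_∘_; _$_; const; _↔_; mk↔ₛ′; Inverse; mk⇔; Equivalence; Injection)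
open import Function.Properties.Inverse using (↔⇒↣; ↔-trans; ↔-sym; ↔-refl)
open import Data.Sum.Function.Propositional using (_⊎-↔_)
open import Data.Fin.Permutation using (Permutation′; _⟨$⟩ʳ_; _⟨$⟩ˡ_; inverseʳ; transpose)
open import Relation.Nullary using (¬_; contradiction; does; yes; no; Dec; ¬?; _×-dec_; _→-dec_)
import Relation.Nullary.Decidable as Dec
open import Relation.Unary using (Decidable)
open import Relation.Nullary.Decidable using (dec-true; dec-false; does-⇔)
open import Relation.Binary.PropositionalEquality

private variable
  d : ℕ

∑-↑ : ∀ m d (h : Fin (m + d) → ℕ) → ∑ h ≡ ∑ (h ∘ (_↑ˡ d)) + ∑ (h ∘ (m ↑ʳ_))
∑-↑ zero    d h = refl
∑-↑ (suc m) d h = trans (cong (h zero +_) (∑-↑ m d (h ∘ suc))) (sym (+-assoc (h zero) _ _))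

∑-const : ∀ n c → ∑[ i < n ] c ≡ n * c
∑-const zero    c = refl
∑-const (suc n) c = cong (c +_) (∑-const n c)

∑-mono-≤ : {f g : Fin d → ℕ} → (∀ i → f i ≤ g i) → ∑ f ≤ ∑ g
∑-mono-≤ {zero}  f≤g = z≤n
∑-mono-≤ {suc d} f≤g = +-mono-≤ (f≤g zero) (∑-mono-≤ (f≤g ∘ suc))

n≤∑ : (f : Fin d → ℕ) → (∀ i → 1 ≤ f i) → d ≤ ∑ f
n≤∑ {d} f 1≤f = begin
  d         ≡⟨ sym (*-identityʳ d) ⟩
  d * 1     ≡⟨ sym (∑-const d 1) ⟩
  ∑[ i < d ] 1 ≤⟨ ∑-mono-≤ 1≤f ⟩
  ∑ f       ∎
  where open ≤-Reasoning

n≤1+∑ : (f : Fin d → ℕ) → (∀ i j → i ≢ j → 1 ≤ f i ⊎ 1 ≤ f j) → d ≤ suc (∑ f)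
n≤1+∑ {zero}  f _ = z≤n
n≤1+∑ {suc d} f 1≤f with f zero in eq
... | zero  = s≤s (n≤∑ (f ∘ suc) tail-positive)
  where
  tail-positive : ∀ i → 1 ≤ f (suc i)
  tail-positive i with 1≤f zero (suc i) (λ ())
  ... | inj₁ 1≤f₀ = ⊥-elim (1+n≰n (≤-trans 1≤f₀ (≤-reflexive eq)))
  ... | inj₂ 1≤fᵢ = 1≤fᵢ
... | suc a = s≤s (≤-trans (n≤1+∑ (f ∘ suc) (λ i j i≢j → 1≤f (suc i) (suc j) (i≢j ∘ Fin.suc-injective)))
                           (+-monoˡ-≤ (∑ (f ∘ suc)) (s≤s z≤n)))

sum-tabulate : (f : Fin d → ℕ) → sum (tabulate f) ≡ ∑ f
sum-tabulate {zero}  f = refl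
sum-tabulate {suc d} f = cong (f zero +_) (sum-tabulate (f ∘ suc))

cost≡∑ : (G : Graph) (f : Fin (n G) → ℕ) → cost G f ≡ ∑ f
cost≡∑ G f = trans (cong sum (map-tabulate (λ i → i) f)) (sum-tabulate f)

module _ {n} (p : Fin n → Bool) where

  any-allFin⁻ : any p (allFin n) ≡ true → ∃ λ w → p w ≡ true
  any-allFin⁻ e with satisfied (any⁻ p (allFin n) (Equivalence.from T-≡ e))
  ... | w , pw = w , Equivalence.to T-≡ pw

  any-allFin⁺ : ∀ w → p w ≡ true → any p (allFin n) ≡ true
  any-allFin⁺ w e = Equivalence.to T-≡ (any⁺ p (lose (∈-allFin w) (Equivalence.from T-≡ e)))

-- Reachability and truncated distance

minUpTo-least : ∀ (q : ℕ → Bool) m j → j ≤ m → q j ≡ true → (∀ i → i < j → q i ≡ false) → minUpTo q m ≡ j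
minUpTo-least q zero    zero    _       qj _ rewrite qj = refl
minUpTo-least q (suc m) zero    _       qj _ rewrite qj = refl
minUpTo-least q (suc m) (suc j) (s≤s j≤m) qj below rewrite below 0 (s≤s z≤n) =
  cong suc (minUpTo-least (q ∘ suc) m j j≤m qj (λ i i<j → below (suc i) (s≤s i<j)))

minUpTo-none : ∀ (q : ℕ → Bool) m → (∀ i → i ≤ m → q i ≡ false) → minUpTo q m ≡ suc m
minUpTo-none q zero    none rewrite none 0 z≤n = refl
minUpTo-none q (suc m) none rewrite none 0 z≤n =
  cong suc (minUpTo-none (q ∘ suc) m (λ i i≤m → none (suc i) (s≤s i≤m)))

minUpTo-cong : ∀ {p q : ℕ → Bool} → (∀ j → p j ≡ q j) → ∀ m → minUpTo p m ≡ minUpTo q m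
minUpTo-cong p≗q zero    rewrite p≗q 0 = refl
minUpTo-cong p≗q (suc m) rewrite p≗q 0 = cong (λ t → if _ then 0 else suc t) (minUpTo-cong (p≗q ∘ suc) m)

minUpTo-sound : ∀ (q : ℕ → Bool) m → minUpTo q m ≤ m → q (minUpTo q m) ≡ true
minUpTo-sound q zero    _ with q 0 in e
... | true = e
minUpTo-sound q (suc m) _ with q 0 in e
... | true = e
minUpTo-sound q (suc m) (s≤s ≤m) | false = minUpTo-sound (q ∘ suc) m ≤m

does-≟⇒≡ : ∀ {m} {a b : Fin m} → does (a Fin.≟ b) ≡ true → a ≡ b
does-≟⇒≡ {a = a} {b} e with a Fin.≟ b
... | yes a≡b = a≡b

module _ (G : Graph) where

  private
    V = Fin (n G)

  adj⇒≢ : ∀ {x z : V} → adj G x z ≡ true → x ≢ z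
  adj⇒≢ {x} e refl with trans (sym e) (irrefl G x)
  ... | ()

  reach-refl : ∀ (x : V) → reach G 0 x x ≡ true
  reach-refl x = dec-true (x Fin.≟ x) refl

  reach-≢ : ∀ {x z : V} → x ≢ z → reach G 0 x z ≡ false
  reach-≢ {x} {z} = dec-false (x Fin.≟ z)

  reach-zero⁻ : ∀ (x z : V) → reach G 0 x z ≡ true → x ≡ z
  reach-zero⁻ x z = does-≟⇒≡

  reach-suc : ∀ j (x z : V) → reach G j x z ≡ true → reach G (suc j) x z ≡ true
  reach-suc j x z e rewrite e = refl

  reach-step : ∀ j (x w z : V) → reach G j x w ≡ true → adj G w z ≡ true → reach G (suc j) x z ≡ true
  reach-step j x w z xw wz with reach G j x z
  ... | true  = refl
  ... | false = any-allFin⁺ (λ w → reach G j x w ∧ adj G w z) w (cong₂ _∧_ xw wz)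

  reach-suc⁻ : ∀ j (x z : V) → reach G (suc j) x z ≡ true →
               reach G j x z ≡ true ⊎ ∃ λ w → reach G j x w ≡ true × adj G w z ≡ true
  reach-suc⁻ j x z e with reach G j x z
  ... | true  = inj₁ refl
  ... | false with any-allFin⁻ (λ w → reach G j x w ∧ adj G w z) e
  ...   | w , xwz = inj₂ (w , ∧-conicalˡ _ _ xwz , ∧-conicalʳ _ _ xwz)

  reach-≤ : ∀ {i j} (x z : V) → i ≤ j → reach G i x z ≡ true → reach G j x z ≡ true
  reach-≤ {i} {j} x z i≤j e with m≤n⇒m<n∨m≡n i≤j
  ... | inj₂ refl = e
  reach-≤ {i} {suc j} x z _ e | inj₁ (s≤s i≤j) = reach-suc j x z (reach-≤ x z i≤j e)

  reach-one⁻ : ∀ (x z : V) → reach G 1 x z ≡ true → x ≡ z ⊎ adj G x z ≡ true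
  reach-one⁻ x z e with reach-suc⁻ 0 x z e
  ... | inj₁ xz = inj₁ (reach-zero⁻ x z xz)
  ... | inj₂ (w , xw , wz) with reach-zero⁻ x w xw
  ...   | refl = inj₂ wz

  reach-two⁻ : ∀ (x z : V) → reach G 2 x z ≡ true →
               x ≡ z ⊎ adj G x z ≡ true ⊎ ∃ λ w → adj G x w ≡ true × adj G w z ≡ true
  reach-two⁻ x z e with reach-suc⁻ 1 x z e
  ... | inj₁ xz = map₂ inj₁ (reach-one⁻ x z xz)
  ... | inj₂ (w , xw , wz) with reach-one⁻ x w xw
  ...   | inj₁ refl = inj₂ (inj₁ wz)
  ...   | inj₂ xw′  = inj₂ (inj₂ (w , xw′ , wz))

  dk-refl : ∀ f (x : V) → dk G f x x ≡ 0
  dk-refl f x = minUpTo-least (λ j → reach G j x x) f 0 z≤n (reach-refl x) (λ _ ())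

  dk-exact : ∀ f j {x z : V} → j ≤ f → reach G j x z ≡ true →
             (∀ i → i < j → reach G i x z ≡ false) → dk G f x z ≡ j
  dk-exact f j = minUpTo-least _ f j

  dk-adj : ∀ f {x z : V} → adj G x z ≡ true → dk G (suc f) x z ≡ 1
  dk-adj f {x} {z} xz = dk-exact (suc f) 1 (s≤s z≤n) (reach-step 0 x x z (reach-refl x) xz)
    λ { zero _ → reach-≢ (adj⇒≢ xz) ; (suc _) (s≤s ()) }

  dk-unreachable : ∀ f (x z : V) → reach G f x z ≡ false → dk G f x z ≡ suc f
  dk-unreachable f x z far = minUpTo-none _ f λ i i≤f → not-reached i≤f
    where
    not-reached : ∀ {i} → i ≤ f → reach G i x z ≡ false
    not-reached {i} i≤f with reach G i x z in e
    ... | false = refl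
    ... | true  = trans (sym (reach-≤ x z i≤f e)) far

  dk-reached : ∀ f {j} (x z : V) → dk G f x z ≡ j → j ≤ f → reach G j x z ≡ true
  dk-reached f x z refl = minUpTo-sound _ f

  dk-two : ∀ {x w z : V} → adj G x w ≡ true → adj G w z ≡ true → x ≢ z → adj G x z ≡ false → dk G 2 x z ≡ 2
  dk-two {x} {w} {z} xw wz x≢z xz = dk-exact 2 2 ≤-refl
    (reach-step 1 x w z (reach-step 0 x x w (reach-refl x) xw) wz) below
    where
    below : ∀ i → i < 2 → reach G i x z ≡ false
    below zero    _ = reach-≢ x≢z
    below (suc zero) _ = ¬-not λ e →
      [ x≢z , (λ xz′ → contradiction (trans (sym xz′) xz) (λ ())) ]′ (reach-one⁻ x z e)
    below (suc (suc _)) (s≤s (s≤s ()))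

  self-separates : ∀ f {y z : V} → y ≢ z → dk G f z z ≢ dk G f y z
  self-separates f {y} {z} y≢z e = y≢z (reach-zero⁻ y z (dk-reached f y z (trans (sym e) (dk-refl f z)) z≤n))

  adj-separates : ∀ {f} {x y z : V} → 0 < f → adj G x z ≡ true → y ≢ z → adj G y z ≡ false →
                  dk G f x z ≢ dk G f y z
  adj-separates {suc f} {x} {y} {z} _ xz y≢z yz e
    with reach-one⁻ y z (dk-reached (suc f) y z (trans (sym e) (dk-adj f xz)) (s≤s z≤n))
  ... | inj₁ y≡z = y≢z y≡z
  ... | inj₂ yz′ with trans (sym yz′) yz
  ...   | ()

-- Automorphisms, twins and leaves

IsAutomorphism : (G : Graph) → Permutation′ (n G) → Set
IsAutomorphism G π = ∀ a b → adj G (π ⟨$⟩ʳ a) (π ⟨$⟩ʳ b) ≡ adj G a b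

any-permute : ∀ {m} (π : Permutation′ m) (p : Fin m → Bool) →
              any p (allFin m) ≡ any (p ∘ (π ⟨$⟩ʳ_)) (allFin m)
any-permute π p = ⇔→≡ {z = true} (mk⇔ to from)
  where
  to : any p (allFin _) ≡ true → any (p ∘ (π ⟨$⟩ʳ_)) (allFin _) ≡ true
  to e with any-allFin⁻ p e
  ... | w , pw = any-allFin⁺ _ (π ⟨$⟩ˡ w) (trans (cong p (inverseʳ π)) pw)
  from : any (p ∘ (π ⟨$⟩ʳ_)) (allFin _) ≡ true → any p (allFin _) ≡ true
  from e with any-allFin⁻ _ e
  ... | w , pw = any-allFin⁺ p (π ⟨$⟩ʳ w) pw

module _ (G : Graph) {π : Permutation′ (n G)} (π-aut : IsAutomorphism G π) where

  reach-automorphism : ∀ j x z → reach G j (π ⟨$⟩ʳ x) (π ⟨$⟩ʳ z) ≡ reach G j x z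
  reach-automorphism zero    x z =
    does-⇔ (mk⇔ (Injection.injective (↔⇒↣ π)) (cong (π ⟨$⟩ʳ_)))
           ((π ⟨$⟩ʳ x) Fin.≟ (π ⟨$⟩ʳ z)) (x Fin.≟ z)
  reach-automorphism (suc j) x z = cong₂ _∨_ (reach-automorphism j x z) (begin
    any (λ w → reach G j (π ⟨$⟩ʳ x) w ∧ adj G w (π ⟨$⟩ʳ z)) (allFin (n G))
      ≡⟨ any-permute π _ ⟩
    any (λ w → reach G j (π ⟨$⟩ʳ x) (π ⟨$⟩ʳ w) ∧ adj G (π ⟨$⟩ʳ w) (π ⟨$⟩ʳ z)) (allFin (n G))
      ≡⟨ cong or (map-cong (λ w → cong₂ _∧_ (reach-automorphism j x w) (π-aut w z)) (allFin (n G))) ⟩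
    any (λ w → reach G j x w ∧ adj G w z) (allFin (n G)) ∎)
    where open ≡-Reasoning

  dk-automorphism : ∀ f x z → dk G f (π ⟨$⟩ʳ x) (π ⟨$⟩ʳ z) ≡ dk G f x z
  dk-automorphism f x z = minUpTo-cong (λ j → reach-automorphism j x z) f

transpose-cases : ∀ {m} (x y a : Fin m) →
                  (a ≡ x × transpose x y ⟨$⟩ʳ a ≡ y) ⊎ (a ≡ y × transpose x y ⟨$⟩ʳ a ≡ x) ⊎
                  (a ≢ x × a ≢ y × transpose x y ⟨$⟩ʳ a ≡ a)
transpose-cases x y a with a Fin.≟ x
... | yes a≡x = inj₁ (a≡x , refl)
... | no  a≢x with a Fin.≟ y
...   | yes a≡y = inj₂ (inj₁ (a≡y , refl))
...   | no  a≢y = inj₂ (inj₂ (a≢x , a≢y , refl))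

module _ (G : Graph) where

  private
    V = Fin (n G)

  Twins : V → V → Set
  Twins x y = ∀ z → z ≢ x → z ≢ y → adj G x z ≡ adj G y z

  module _ {x y : V} (twins : Twins x y) where

    private
      τ : V → V
      τ = transpose x y ⟨$⟩ʳ_

    τ-fixed : ∀ a {c} → c ≢ x → c ≢ y → adj G (τ a) c ≡ adj G a c
    τ-fixed a c≢x c≢y with transpose-cases x y a
    ... | inj₁ (refl , τa≡y) rewrite τa≡y = sym (twins _ c≢x c≢y)
    ... | inj₂ (inj₁ (refl , τa≡x)) rewrite τa≡x = twins _ c≢x c≢y
    ... | inj₂ (inj₂ (_ , _ , τa≡a)) rewrite τa≡a = refl

    τ-fixedʳ : ∀ b {c} → c ≢ x → c ≢ y → adj G c (τ b) ≡ adj G c b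
    τ-fixedʳ b {c} c≢x c≢y = trans (Graph.sym G c (τ b)) (trans (τ-fixed b c≢x c≢y) (Graph.sym G b c))

    transpose-automorphism : IsAutomorphism G (transpose x y)
    transpose-automorphism a b with transpose-cases x y a | transpose-cases x y b
    ... | inj₂ (inj₂ (a≢x , a≢y , τa≡a)) | _ rewrite τa≡a = τ-fixedʳ b a≢x a≢y
    ... | _ | inj₂ (inj₂ (b≢x , b≢y , τb≡b)) rewrite τb≡b = τ-fixed a b≢x b≢y
    ... | inj₁ (refl , τa≡y)        | inj₁ (refl , τb≡y)
      rewrite τa≡y | τb≡y = trans (irrefl G y) (sym (irrefl G x))
    ... | inj₁ (refl , τa≡y)        | inj₂ (inj₁ (refl , τb≡x))
      rewrite τa≡y | τb≡x = Graph.sym G y x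
    ... | inj₂ (inj₁ (refl , τa≡x)) | inj₁ (refl , τb≡y)
      rewrite τa≡x | τb≡y = Graph.sym G x y
    ... | inj₂ (inj₁ (refl , τa≡x)) | inj₂ (inj₁ (refl , τb≡x))
      rewrite τa≡x | τb≡x = trans (irrefl G x) (sym (irrefl G y))

  twins-dk : ∀ {x y} → Twins x y → ∀ f {z} → z ≢ x → z ≢ y → dk G f x z ≡ dk G f y z
  twins-dk {x} {y} twins f {z} z≢x z≢y = begin
    dk G f x z             ≡⟨ sym (dk-automorphism G {transpose x y} (transpose-automorphism twins) f x z) ⟩
    dk G f (τ x) (τ z)     ≡⟨ cong₂ (dk G f) τx≡y τz≡z ⟩
    dk G f y z             ∎
    where
    open ≡-Reasoning
    τ : V → V
    τ = transpose x y ⟨$⟩ʳ_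
    τx≡y : τ x ≡ y
    τx≡y with transpose-cases x y x
    ... | inj₁ (_ , e)                = e
    ... | inj₂ (inj₁ (refl , e))      = e
    ... | inj₂ (inj₂ (x≢x , _ , _))   = ⊥-elim (x≢x refl)
    τz≡z : τ z ≡ z
    τz≡z with transpose-cases x y z
    ... | inj₁ (z≡x , _)              = ⊥-elim (z≢x z≡x)
    ... | inj₂ (inj₁ (z≡y , _))       = ⊥-elim (z≢y z≡y)
    ... | inj₂ (inj₂ (_ , _ , e))     = e

  twins-resolvedBy : ∀ {x y} → Twins x y → ∀ f z → dk G f x z ≢ dk G f y z → z ≡ x ⊎ z ≡ y
  twins-resolvedBy {x} {y} twins f z resolves with z Fin.≟ x | z Fin.≟ y
  ... | yes z≡x | _       = inj₁ z≡x
  ... | no  _   | yes z≡y = inj₂ z≡y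
  ... | no  z≢x | no  z≢y = ⊥-elim (resolves (twins-dk twins f z≢x z≢y))

  LeafOf : V → V → Set
  LeafOf x u = ∀ w → adj G x w ≡ true → w ≡ u

  module _ {x u : V} (leaf : LeafOf x u) {z : V} (z≢x : z ≢ x) (z≢u : z ≢ u) where

    leaf-dk₁ : dk G 1 x z ≡ 2
    leaf-dk₁ = dk-unreachable G 1 x z (¬-not λ e →
      [ z≢x ∘ sym , (λ xz → z≢u (leaf z xz)) ]′ (reach-one⁻ G x z e))

    leaf-dk₂ : adj G u z ≡ false → dk G 2 x z ≡ 3
    leaf-dk₂ uz = dk-unreachable G 2 x z (¬-not λ e → unreachable (reach-two⁻ G x z e))
      where
      unreachable : x ≡ z ⊎ adj G x z ≡ true ⊎ ∃ (λ w → adj G x w ≡ true × adj G w z ≡ true) → ⊥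
      unreachable (inj₁ x≡z)                      = z≢x (sym x≡z)
      unreachable (inj₂ (inj₁ xz))                = z≢u (leaf z xz)
      unreachable (inj₂ (inj₂ (w , xw , wz))) with leaf w xw
      ... | refl with trans (sym wz) uz
      ...   | ()

  leaves-resolvedBy : ∀ {x u y v} → LeafOf x u → LeafOf y v → ∀ z → dk G 1 x z ≢ dk G 1 y z →
                      (z ≡ x ⊎ z ≡ u) ⊎ (z ≡ y ⊎ z ≡ v)
  leaves-resolvedBy {x} {u} {y} {v} leafₓ leafᵧ z resolves
    with z Fin.≟ x | z Fin.≟ u | z Fin.≟ y | z Fin.≟ v
  ... | yes z≡x | _       | _       | _       = inj₁ (inj₁ z≡x)
  ... | no  _   | yes z≡u | _       | _       = inj₁ (inj₂ z≡u)
  ... | no  _   | no  _   | yes z≡y | _       = inj₂ (inj₁ z≡y)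
  ... | no  _   | no  _   | no  _   | yes z≡v = inj₂ (inj₂ z≡v)
  ... | no  z≢x | no  z≢u | no  z≢y | no  z≢v =
    ⊥-elim (resolves (trans (leaf-dk₁ leafₓ z≢x z≢u) (sym (leaf-dk₁ leafᵧ z≢y z≢v))))

-- Lower bounds forced by twins and leaves

indicator : ∀ {m} → Subset m → Fin m → ℕ
indicator A i = if lookup A i then 1 else 0

∣∣≡∑-indicator : ∀ {m} (A : Subset m) → ∣ A ∣ ≡ ∑ (indicator A)
∣∣≡∑-indicator []            = refl
∣∣≡∑-indicator (true  ∷ᵛ A)   = cong suc (∣∣≡∑-indicator A)
∣∣≡∑-indicator (false ∷ᵛ A)   = ∣∣≡∑-indicator A

∈⇒1≤indicator : ∀ {m} {A : Subset m} {x} → x ∈ A → 1 ≤ indicator A x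
∈⇒1≤indicator x∈A rewrite []=⇒lookup x∈A = s≤s z≤n

1≤+ : ∀ {m} (w : Fin m → ℕ) {x y z} → z ≡ x ⊎ z ≡ y → 1 ≤ w z → 1 ≤ w x + w y
1≤+ w (inj₁ refl) 1≤wz = ≤-trans 1≤wz (m≤m+n _ _)
1≤+ w (inj₂ refl) 1≤wz = ≤-trans 1≤wz (m≤n+m _ _)

module _ (G : Graph) {x y : Fin (n G)} (x≢y : x ≢ y) where

  twins-broadcast : ∀ {f} → IsResolvingBroadcast G f → Twins G x y → 1 ≤ f x + f y
  twins-broadcast {f} resolving twins with resolving x y x≢y
  ... | z , 0<fz , resolves = 1≤+ f (twins-resolvedBy G twins (f z) z resolves) 0<fz

  twins-adjResolving : ∀ {A} → IsAdjResolvingSet G A → Twins G x y → 1 ≤ indicator A x + indicator A y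
  twins-adjResolving {A} resolving twins with resolving x y x≢y
  ... | z , z∈A , resolves = 1≤+ (indicator A) (twins-resolvedBy G twins 1 z resolves) (∈⇒1≤indicator z∈A)

  leaves-adjResolving : ∀ {A u v} → IsAdjResolvingSet G A → LeafOf G x u → LeafOf G y v →
                        1 ≤ indicator A x + indicator A u ⊎ 1 ≤ indicator A y + indicator A v
  leaves-adjResolving {A} resolving leafₓ leafᵧ with resolving x y x≢y
  ... | z , z∈A , resolves = Data.Sum.map (λ z∈xu → 1≤+ (indicator A) z∈xu (∈⇒1≤indicator z∈A))
                                          (λ z∈yv → 1≤+ (indicator A) z∈yv (∈⇒1≤indicator z∈A))
                                          (leaves-resolvedBy G leafₓ leafᵧ z resolves)

-- Existence of bdim and adim

least-witness : ∀ {P : ℕ → Set} → Decidable P → ∀ {c} → P c → ∃ λ m → P m × (∀ c → P c → m ≤ c)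
least-witness {P} P? {c} Pc = search c 0 (λ _ ()) (subst P (sym (+-identityʳ c)) Pc)
  where
  search : ∀ d s → (∀ m → m < s → ¬ P m) → P (d + s) → ∃ λ m → P m × (∀ c → P c → m ≤ c)
  search zero    s below Ps = s , Ps , λ c Pc → ≮⇒≥ (λ c<s → below c c<s Pc)
  search (suc d) s below Pd+s with P? s
  ... | yes Ps = s , Ps , λ c Pc → ≮⇒≥ (λ c<s → below c c<s Pc)
  ... | no ¬Ps = search d (suc s) below′ (subst P (sym (+-suc d s)) Pd+s)
    where
    below′ : ∀ m → m < suc s → ¬ P m
    below′ m (s≤s m≤s) with m≤n⇒m<n∨m≡n m≤s
    ... | inj₁ m<s  = below m m<s
    ... | inj₂ refl = ¬Ps

∃-∑≡? : ∀ {m} {P : (Fin m → ℕ) → Set} → Decidable P → (∀ {f g} → f ≗ g → P f → P g) →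
        ∀ c → Dec (∃ λ f → P f × ∑ f ≡ c)
∃-∑≡? {zero} P? resp zero with P? (λ ())
... | yes p = yes ((λ ()) , p , refl)
... | no ¬p = no λ (f , p , _) → ¬p (resp (λ ()) p)
∃-∑≡? {zero}  P? resp (suc c) = no λ ()
∃-∑≡? {suc m} {P} P? resp c
  with Fin.any? {suc c} (λ a →
         ∃-∑≡? (P? ∘ (toℕ a ∷_)) (λ f≗g → resp λ { zero → refl ; (suc i) → f≗g i }) (c ∸ toℕ a))
... | yes (a , g , p , ∑g≡c∸a) =
  yes (toℕ a ∷ g , p , trans (cong (toℕ a +_) ∑g≡c∸a) (m+[n∸m]≡n (≤-pred (Fin.toℕ<n a))))
... | no ¬split = no λ (f , p , ∑f≡c) → ¬split (split f p ∑f≡c)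
  where
  split : ∀ f → P f → ∑ f ≡ c → ∃ λ (a : Fin (suc c)) → ∃ λ g → P (toℕ a ∷ g) × ∑ g ≡ c ∸ toℕ a
  split f p ∑f≡c = a , tail f , resp head-tail p , ∑tail
    where
    f₀≤c : f zero ≤ c
    f₀≤c = ≤-trans (m≤m+n (f zero) _) (≤-reflexive ∑f≡c)
    a : Fin (suc c)
    a = fromℕ< (s≤s f₀≤c)
    head-tail : f ≗ toℕ a ∷ tail f
    head-tail zero    = sym (Fin.toℕ-fromℕ< (s≤s f₀≤c))
    head-tail (suc i) = refl
    ∑tail : ∑ (tail f) ≡ c ∸ toℕ a
    ∑tail = begin
      ∑ (tail f)                  ≡⟨ sym (m+n∸m≡n (f zero) _) ⟩
      f zero + ∑ (tail f) ∸ f zero ≡⟨ cong₂ _∸_ ∑f≡c (sym (Fin.toℕ-fromℕ< (s≤s f₀≤c))) ⟩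
      c ∸ toℕ a                   ∎
      where open ≡-Reasoning

module _ (G : Graph) where

  private
    V = Fin (n G)

  IsResolvingBroadcast? : Decidable (IsResolvingBroadcast G)
  IsResolvingBroadcast? f = Fin.all? λ x → Fin.all? λ y → ¬? (x Fin.≟ y) →-dec
    Fin.any? λ z → (0 <? f z) ×-dec ¬? (dk G (f z) x z ≟ dk G (f z) y z)

  IsAdjResolvingSet? : Decidable (IsAdjResolvingSet G)
  IsAdjResolvingSet? A = Fin.all? λ x → Fin.all? λ y → ¬? (x Fin.≟ y) →-dec
    Fin.any? λ z → (z ∈? A) ×-dec ¬? (dk G 1 x z ≟ dk G 1 y z)

  resolving-resp : ∀ {f g} → f ≗ g → IsResolvingBroadcast G f → IsResolvingBroadcast G g
  resolving-resp f≗g resolving x y x≢y with resolving x y x≢y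
  ... | z , 0<fz , resolves = z , subst (0 <_) (f≗g z) 0<fz , subst (λ r → dk G r x z ≢ dk G r y z) (f≗g z) resolves

  bdim-exists : ∃ (IsBdim G)
  bdim-exists =
    let b , witness , least = least-witness has-cost? (const 1 , all-ones-resolving , refl)
    in  b , witness , λ f r → least (cost G f) (f , r , refl)
    where
    has-cost? : Decidable (λ c → ∃ λ f → IsResolvingBroadcast G f × cost G f ≡ c)
    has-cost? c = Dec.map′ (λ (f , r , e) → f , r , trans (cost≡∑ G f) e)
                           (λ (f , r , e) → f , r , trans (sym (cost≡∑ G f)) e)
                           (∃-∑≡? IsResolvingBroadcast? resolving-resp c)
    all-ones-resolving : IsResolvingBroadcast G (const 1)
    all-ones-resolving x y x≢y = x , s≤s z≤n , self-separates G 1 (x≢y ∘ sym)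

  adim-exists : ∃ (IsAdim G)
  adim-exists =
    let a , witness , least = least-witness has-size? (⊤ , everything-resolving , refl)
    in  a , witness , λ A r → least ∣ A ∣ (A , r , refl)
    where
    has-size? : Decidable (λ c → ∃ λ A → IsAdjResolvingSet G A × ∣ A ∣ ≡ c)
    has-size? c = anySubset? (λ A → IsAdjResolvingSet? A ×-dec (∣ A ∣ ≟ c))
    everything-resolving : IsAdjResolvingSet G ⊤
    everything-resolving x y x≢y = x , ∈⊤ , self-separates G 1 (x≢y ∘ sym)

-- The graphs G_k

graphOn : ∀ {m} (E : Fin m → Fin m → Bool) → (∀ x → E x x ≡ false) → Graph
graphOn {m} E E-irrefl = record
  { n      = m
  ; adj    = λ x y → E x y ∨ E y x
  ; sym    = λ x y → ∨-comm (E x y) (E y x)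
  ; irrefl = λ x → cong (λ b → b ∨ b) (E-irrefl x)
  }

funToFin-cong : ∀ {m d} {f g : Fin m → Fin d} → f ≗ g → funToFin f ≡ funToFin g
funToFin-cong {zero}  f≗g = refl
funToFin-cong {suc m} f≗g = cong₂ combine (f≗g zero) (funToFin-cong (f≗g ∘ suc))

-- u : Fin (2 ^ k) stands for the subset of Fin k given by its base-2 digits.
bit : ∀ {k} → Fin (2 ^ k) → Fin k → Bool
bit u i = Inverse.to 2↔Bool (finToFun u i)

bit-differs : ∀ {k} {u u′ : Fin (2 ^ k)} → u ≢ u′ → ∃ λ i → bit u i ≢ bit u′ i
bit-differs {k} {u} {u′} u≢u′ =
  let i , digits≢ = ¬∀⟶∃¬ k _ (λ i → finToFun u i Fin.≟ finToFun u′ i) digits-differ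
  in  i , digits≢ ∘ Injection.injective (↔⇒↣ 2↔Bool)
  where
  digits-differ : ¬ (∀ i → finToFun u i ≡ finToFun u′ i)
  digits-differ u≗u′ = u≢u′ (begin
    u                              ≡⟨ funToFin-finToFin {k} {2} u ⟨
    funToFin (finToFun {2} {k} u)  ≡⟨ funToFin-cong u≗u′ ⟩
    funToFin (finToFun {2} {k} u′) ≡⟨ funToFin-finToFin {k} {2} u′ ⟩
    u′                             ∎)
    where open ≡-Reasoning

data Vertex (k : ℕ) : Set where
  P Q M : Fin k → Vertex k
  R     : Vertex k
  S L   : Fin (2 ^ k) → Vertex k

edge : ∀ {k} → Vertex k → Vertex k → Bool
edge (P i) (M j)  = does (i Fin.≟ j)
edge (Q i) (M j)  = does (i Fin.≟ j)
edge (M i) (S u)  = bit u i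
edge R     (S u)  = true
edge (S u) (L u′) = does (u Fin.≟ u′)
edge _     _      = false

edge-irrefl : ∀ {k} (a : Vertex k) → edge a a ≡ false
edge-irrefl (P i) = refl
edge-irrefl (Q i) = refl
edge-irrefl (M i) = refl
edge-irrefl R     = refl
edge-irrefl (S u) = refl
edge-irrefl (L u) = refl

link : ∀ {k} → Vertex k → Vertex k → Bool
link a b = edge a b ∨ edge b a

order : ℕ → ℕ
order k = k + (k + (k + (1 + (2 ^ k + 2 ^ k))))

vertex↔fin : ∀ k → Vertex k ↔ Fin (order k)
vertex↔fin k = ↔-trans (mk↔ₛ′ to from to∘from from∘to)
  (↔-sym (↔-trans +↔⊎ (↔-refl ⊎-↔ ↔-trans +↔⊎ (↔-refl ⊎-↔ ↔-trans +↔⊎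
                     (↔-refl ⊎-↔ ↔-trans +↔⊎ (↔-refl ⊎-↔ +↔⊎))))))
  where
  Blocks : Set
  Blocks = Fin k ⊎ (Fin k ⊎ (Fin k ⊎ (Fin 1 ⊎ (Fin (2 ^ k) ⊎ Fin (2 ^ k)))))
  to : Vertex k → Blocks
  to (P i) = inj₁ i
  to (Q i) = inj₂ (inj₁ i)
  to (M i) = inj₂ (inj₂ (inj₁ i))
  to R     = inj₂ (inj₂ (inj₂ (inj₁ zero)))
  to (S u) = inj₂ (inj₂ (inj₂ (inj₂ (inj₁ u))))
  to (L u) = inj₂ (inj₂ (inj₂ (inj₂ (inj₂ u))))
  from : Blocks → Vertex k
  from (inj₁ i)                             = P i
  from (inj₂ (inj₁ i))                      = Q i
  from (inj₂ (inj₂ (inj₁ i)))               = M i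
  from (inj₂ (inj₂ (inj₂ (inj₁ _))))        = R
  from (inj₂ (inj₂ (inj₂ (inj₂ (inj₁ u))))) = S u
  from (inj₂ (inj₂ (inj₂ (inj₂ (inj₂ u))))) = L u
  to∘from : ∀ b → to (from b) ≡ b
  to∘from (inj₁ i)                             = refl
  to∘from (inj₂ (inj₁ i))                      = refl
  to∘from (inj₂ (inj₂ (inj₁ i)))               = refl
  to∘from (inj₂ (inj₂ (inj₂ (inj₁ zero))))     = refl
  to∘from (inj₂ (inj₂ (inj₂ (inj₂ (inj₁ u))))) = refl
  to∘from (inj₂ (inj₂ (inj₂ (inj₂ (inj₂ u))))) = refl
  from∘to : ∀ a → from (to a) ≡ a
  from∘to (P i) = refl
  from∘to (Q i) = refl
  from∘to (M i) = refl
  from∘to R     = refl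
  from∘to (S u) = refl
  from∘to (L u) = refl

module _ (k : ℕ) where

  enc : Vertex k → Fin (order k)
  enc = Inverse.to (vertex↔fin k)

  dec : Fin (order k) → Vertex k
  dec = Inverse.from (vertex↔fin k)

  dec∘enc : ∀ a → dec (enc a) ≡ a
  dec∘enc = Inverse.strictlyInverseʳ (vertex↔fin k)

  enc∘dec : ∀ x → enc (dec x) ≡ x
  enc∘dec = Inverse.strictlyInverseˡ (vertex↔fin k)

  enc-injective : ∀ {a b} → enc a ≡ enc b → a ≡ b
  enc-injective {a} {b} e = trans (sym (dec∘enc a)) (trans (cong dec e) (dec∘enc b))

  dec-injective : ∀ {x y} → dec x ≡ dec y → x ≡ y
  dec-injective {x} {y} e = trans (sym (enc∘dec x)) (trans (cong enc e) (enc∘dec y))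

  enc-≢ : ∀ a b → a ≢ b → enc a ≢ enc b
  enc-≢ _ _ a≢b = a≢b ∘ enc-injective

gapGraph : ℕ → Graph
gapGraph k = graphOn (λ x y → edge (dec k x) (dec k y)) (edge-irrefl ∘ dec k)

module _ {k : ℕ} where

  private
    G = gapGraph k

  adj-enc : ∀ (a b : Vertex k) → adj G (enc k a) (enc k b) ≡ link a b
  adj-enc a b rewrite dec∘enc k a | dec∘enc k b = refl

  P-Q-twins : ∀ i → Twins G (enc k (P i)) (enc k (Q i))
  P-Q-twins i z _ _ rewrite dec∘enc k (P i) | dec∘enc k (Q i) = same-links (dec k z)
    where
    same-links : ∀ c → link (P i) c ≡ link (Q i) c
    same-links (P j) = refl
    same-links (Q j) = refl
    same-links (M j) = refl
    same-links R     = refl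
    same-links (S u) = refl
    same-links (L u) = refl

  L-leaf : ∀ (u : Fin (2 ^ k)) → LeafOf G (enc k (L u)) (enc k (S u))
  L-leaf u w Lu-w = trans (sym (enc∘dec k w)) (cong (enc k) (only-link (dec k w) link≡true))
    where
    link≡true : link (L u) (dec k w) ≡ true
    link≡true = trans (sym (adj-enc (L u) (dec k w))) (trans (cong (adj G _) (enc∘dec k w)) Lu-w)
    only-link : ∀ c → link (L u) c ≡ true → c ≡ S u
    only-link (S u′) e′ = cong S (does-≟⇒≡ e′)

  radius : Vertex k → ℕ
  radius (P _) = 1
  radius (M _) = 2
  radius R     = 1
  radius _     = 0

  broadcast : Fin (order k) → ℕ
  broadcast = radius ∘ dec k

  record Resolved (a b : Vertex k) : Set where
    constructor resolved-by
    field
      centre    : Vertex k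
      reaches   : 0 < radius centre
      separates : dk G (radius centre) (enc k a) (enc k centre) ≢ dk G (radius centre) (enc k b) (enc k centre)

  resolved-sym : ∀ {a b} → Resolved a b → Resolved b a
  resolved-sym (resolved-by c 0<r resolves) = resolved-by c 0<r (resolves ∘ sym)

  centre-resolves : ∀ c {b} → 0 < radius c → b ≢ c → Resolved c b
  centre-resolves c 0<r b≢c = resolved-by c 0<r $ self-separates G (radius c) (b≢c ∘ enc-injective k)

  neighbour-resolves : ∀ c {a b} → 0 < radius c → link a c ≡ true → b ≢ c → link b c ≡ false → Resolved a b
  neighbour-resolves c {a} {b} 0<r ac b≢c bc =
    resolved-by c 0<r $ adj-separates G 0<r (trans (adj-enc a c) ac) (b≢c ∘ enc-injective k) (trans (adj-enc b c) bc)

  bit-resolves-leaves : ∀ {u u′} i → bit u i ≡ true → bit u′ i ≡ false → Resolved (L u) (L u′)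
  bit-resolves-leaves {u} {u′} i uᵢ u′ᵢ =
    resolved-by (M i) (s≤s z≤n) λ e → contradiction (trans (sym near) (trans e far)) λ ()
    where
    near : dk G 2 (enc k (L u)) (enc k (M i)) ≡ 2
    near = dk-two G (trans (adj-enc (L u) (S u)) (dec-true (u Fin.≟ u) refl)) (trans (adj-enc (S u) (M i)) uᵢ)
                  (enc-≢ k (L u) (M i) (λ ())) (adj-enc (L u) (M i))
    far : dk G 2 (enc k (L u′)) (enc k (M i)) ≡ 3
    far = leaf-dk₂ G (L-leaf u′) (enc-≢ k (M i) (L u′) (λ ())) (enc-≢ k (M i) (S u′) (λ ()))
                   (trans (adj-enc (S u′) (M i)) u′ᵢ)

  Q-M-linked : ∀ (i : Fin k) → link (Q i) (M i) ≡ true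
  Q-M-linked i = trans (∨-identityʳ _) (dec-true (i Fin.≟ i) refl)

  Q-M-unlinked : ∀ {i j : Fin k} → i ≢ j → link (Q i) (M j) ≡ false
  Q-M-unlinked {i} {j} = trans (∨-identityʳ _) ∘ dec-false (i Fin.≟ j)

  resolved : ∀ a b → a ≢ b → Resolved a b
  resolved (P i) b      a≢b = centre-resolves (P i) (s≤s z≤n) (a≢b ∘ sym)
  resolved (M i) b      a≢b = centre-resolves (M i) (s≤s z≤n) (a≢b ∘ sym)
  resolved R     b      a≢b = centre-resolves R (s≤s z≤n) (a≢b ∘ sym)
  resolved a     (P i)  a≢b = resolved-sym (centre-resolves (P i) (s≤s z≤n) a≢b)
  resolved a     (M i)  a≢b = resolved-sym (centre-resolves (M i) (s≤s z≤n) a≢b)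
  resolved a     R      a≢b = resolved-sym (centre-resolves R (s≤s z≤n) a≢b)
  resolved (Q i) (Q j)  a≢b =
    neighbour-resolves (M i) (s≤s z≤n) (Q-M-linked i) (λ ()) (Q-M-unlinked (a≢b ∘ cong Q ∘ sym))
  resolved (Q i) (S u)  a≢b = resolved-sym (neighbour-resolves R (s≤s z≤n) refl (λ ()) refl)
  resolved (Q i) (L u)  a≢b = neighbour-resolves (M i) (s≤s z≤n) (Q-M-linked i) (λ ()) refl
  resolved (S u) (Q i)  a≢b = neighbour-resolves R (s≤s z≤n) refl (λ ()) refl
  resolved (S u) (L u′) a≢b = neighbour-resolves R (s≤s z≤n) refl (λ ()) refl
  resolved (L u) (Q i)  a≢b = resolved-sym (neighbour-resolves (M i) (s≤s z≤n) (Q-M-linked i) (λ ()) refl)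
  resolved (L u) (S u′) a≢b = resolved-sym (neighbour-resolves R (s≤s z≤n) refl (λ ()) refl)
  resolved (S u) (S u′) a≢b with bit-differs {k} (a≢b ∘ cong S)
  ... | i , bits≢ with bit u i in uᵢ | bit u′ i in u′ᵢ
  ...   | true  | false = neighbour-resolves (M i) (s≤s z≤n) uᵢ (λ ()) u′ᵢ
  ...   | false | true  = resolved-sym (neighbour-resolves (M i) (s≤s z≤n) u′ᵢ (λ ()) uᵢ)
  ...   | true  | true  = ⊥-elim (bits≢ refl)
  ...   | false | false = ⊥-elim (bits≢ refl)
  resolved (L u) (L u′) a≢b with bit-differs {k} (a≢b ∘ cong L)
  ... | i , bits≢ with bit u i in uᵢ | bit u′ i in u′ᵢ
  ...   | true  | false = bit-resolves-leaves i uᵢ u′ᵢ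
  ...   | false | true  = resolved-sym (bit-resolves-leaves i u′ᵢ uᵢ)
  ...   | true  | true  = ⊥-elim (bits≢ refl)
  ...   | false | false = ⊥-elim (bits≢ refl)

  broadcast-resolving : IsResolvingBroadcast G broadcast
  broadcast-resolving x y x≢y with resolved (dec k x) (dec k y) (x≢y ∘ dec-injective k)
  ... | resolved-by c 0<r separates =
    enc k c , subst (λ r → 0 < r × Separates r x y) (sym (cong radius (dec∘enc k c)))
                    (0<r , subst₂ (Separates (radius c)) (enc∘dec k x) (enc∘dec k y) separates)
    where
    Separates : ℕ → Fin (order k) → Fin (order k) → Set
    Separates r x y = dk G r x (enc k c) ≢ dk G r y (enc k c)

  ∑-blocks : ∀ (w : Fin (order k) → ℕ) → ∑ w ≡
    ∑[ i < k ] w (enc k (P i)) + (∑[ i < k ] w (enc k (Q i)) + (∑[ i < k ] w (enc k (M i)) +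
    ((w (enc k R) + 0) + (∑[ u < 2 ^ k ] w (enc k (S u)) + ∑[ u < 2 ^ k ] w (enc k (L u))))))
  ∑-blocks w =
    trans (∑-↑ k N₁ w) (cong (∑ {k} (w ∘ (_↑ˡ N₁)) +_) (
    trans (∑-↑ k N₂ w₁) (cong (∑ {k} (w₁ ∘ (_↑ˡ N₂)) +_) (
    trans (∑-↑ k N₃ w₂) (cong (∑ {k} (w₂ ∘ (_↑ˡ N₃)) +_) (
    trans (∑-↑ 1 N₄ w₃) (cong (∑ {1} (w₃ ∘ (_↑ˡ N₄)) +_) (∑-↑ (2 ^ k) (2 ^ k) (w₃ ∘ (1 ↑ʳ_))))))))))
    where
    N₄ = 2 ^ k + 2 ^ k
    N₃ = 1 + N₄
    N₂ = k + N₃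
    N₁ = k + N₂
    w₁ : Fin N₁ → ℕ
    w₁ = w ∘ (k ↑ʳ_)
    w₂ : Fin N₂ → ℕ
    w₂ = w₁ ∘ (k ↑ʳ_)
    w₃ : Fin N₃ → ℕ
    w₃ = w₂ ∘ (k ↑ʳ_)

  pairs≤∑ : ∀ (w : Fin (order k) → ℕ) →
    ∑[ i < k ] (w (enc k (P i)) + w (enc k (Q i))) + ∑[ u < 2 ^ k ] (w (enc k (L u)) + w (enc k (S u))) ≤ ∑ w
  pairs≤∑ w = begin
    ∑[ i < k ] (p i + q i) + ∑[ u < 2 ^ k ] (l u + s u)
      ≡⟨ cong₂ _+_ (∑-distrib-+ p q) (∑-distrib-+ l s) ⟩
    (∑ p + ∑ q) + (∑ l + ∑ s)
      ≤⟨ +-monoʳ-≤ (∑ p + ∑ q) (m≤n+m _ (∑ m + (w (enc k R) + 0))) ⟩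
    (∑ p + ∑ q) + ((∑ m + (w (enc k R) + 0)) + (∑ l + ∑ s))
      ≡⟨ regroup (∑ p) (∑ q) (∑ m) (w (enc k R) + 0) (∑ l) (∑ s) ⟩
    ∑ p + (∑ q + (∑ m + ((w (enc k R) + 0) + (∑ s + ∑ l))))
      ≡⟨ sym (∑-blocks w) ⟩
    ∑ w ∎
    where
    open ≤-Reasoning
    p q m : Fin k → ℕ
    p i = w (enc k (P i))
    q i = w (enc k (Q i))
    m i = w (enc k (M i))
    s l : Fin (2 ^ k) → ℕ
    s u = w (enc k (S u))
    l u = w (enc k (L u))
    regroup : ∀ a b c d e f → (a + b) + ((c + d) + (e + f)) ≡ a + (b + (c + (d + (f + e))))
    regroup = solve-∀

  bdim-lower : ∀ {f} → IsResolvingBroadcast G f → k ≤ cost G f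
  bdim-lower {f} resolving = begin
    k  ≤⟨ n≤∑ _ (λ i → twins-broadcast G (enc-≢ k (P i) (Q i) (λ ())) resolving (P-Q-twins i)) ⟩
    ∑[ i < k ] (f (enc k (P i)) + f (enc k (Q i)))  ≤⟨ m≤m+n _ _ ⟩
    _  ≤⟨ pairs≤∑ f ⟩
    ∑ f ≡⟨ sym (cost≡∑ G f) ⟩
    cost G f ∎
    where open ≤-Reasoning

  adim-lower : ∀ {A} → 1 ≤ k → IsAdjResolvingSet G A → 2 ^ k ≤ ∣ A ∣
  adim-lower {A} 1≤k resolving = begin
    2 ^ k  ≤⟨ n≤1+∑ _ leaf-pairs ⟩
    suc (∑[ u < 2 ^ k ] (𝟙 (enc k (L u)) + 𝟙 (enc k (S u))))  ≤⟨ +-monoˡ-≤ _ twins ⟩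
    _  ≤⟨ pairs≤∑ 𝟙 ⟩
    ∑ 𝟙 ≡⟨ sym (∣∣≡∑-indicator A) ⟩
    ∣ A ∣ ∎
    where
    open ≤-Reasoning
    𝟙 = indicator A
    twins : 1 ≤ ∑[ i < k ] (𝟙 (enc k (P i)) + 𝟙 (enc k (Q i)))
    twins = ≤-trans 1≤k (n≤∑ _ (λ i → twins-adjResolving G (enc-≢ k (P i) (Q i) (λ ())) resolving (P-Q-twins i)))
    leaf-pairs : ∀ u u′ → u ≢ u′ → 1 ≤ 𝟙 (enc k (L u)) + 𝟙 (enc k (S u)) ⊎ 1 ≤ 𝟙 (enc k (L u′)) + 𝟙 (enc k (S u′))
    leaf-pairs u u′ u≢u′ =
      leaves-adjResolving G (enc-≢ k (L u) (L u′) λ { refl → u≢u′ refl }) resolving (L-leaf u) (L-leaf u′)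

  broadcast-cost : 1 ≤ k → cost G broadcast ≤ 4 * k
  broadcast-cost 1≤k = begin
    cost G broadcast ≡⟨ cost≡∑ G broadcast ⟩
    ∑ broadcast      ≡⟨ ∑-blocks broadcast ⟩
    _                ≡⟨ cong₂ _+_ (block P 1 refl) (cong₂ _+_ (block Q 0 refl) (cong₂ _+_ (block M 2 refl)
                          (cong₂ _+_ (cong (_+ 0) (cong radius (dec∘enc k R)))
                                     (cong₂ _+_ (block S 0 refl) (block L 0 refl))))) ⟩
    k * 1 + (k * 0 + (k * 2 + ((1 + 0) + (2 ^ k * 0 + 2 ^ k * 0))))  ≡⟨ tally k (2 ^ k) ⟩
    1 + 3 * k        ≤⟨ +-monoˡ-≤ (3 * k) 1≤k ⟩
    4 * k            ∎
    where
    open ≤-Reasoning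
    block : ∀ {d} (v : Fin d → Vertex k) r → (∀ {i} → radius (v i) ≡ r) →
            ∑[ i < d ] broadcast (enc k (v i)) ≡ d * r
    block {d} v r radius≡r = trans (sum-cong-≗ λ i → trans (cong radius (dec∘enc k (v i))) radius≡r) (∑-const d r)
    tally : ∀ k p → k * 1 + (k * 0 + (k * 2 + ((1 + 0) + (p * 0 + p * 0)))) ≡ 1 + 3 * k
    tally = solve-∀

  bdim-bounds : ∀ {b} → 1 ≤ k → IsBdim G b → k ≤ b × b ≤ 4 * k
  bdim-bounds 1≤k ((f , resolving , cost≡b) , minimal) =
    subst (k ≤_) cost≡b (bdim-lower resolving) ,
    ≤-trans (minimal broadcast broadcast-resolving) (broadcast-cost 1≤k)

  adim-bound : ∀ {a} → 1 ≤ k → IsAdim G a → 2 ^ k ≤ a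
  adim-bound 1≤k ((A , resolving , ∣A∣≡a) , _) = subst (2 ^ k ≤_) ∣A∣≡a (adim-lower 1≤k resolving)

theorem5p1 : ∃ λ (G : ℕ → Graph) → ∃ λ (a : ℕ) → ∃ λ (b : ℕ) → ∃ λ (c : ℕ) → ∀ (k : ℕ) → 1 ≤ k → ∃ λ (bd : ℕ) → ∃ λ (ad : ℕ) → IsBdim (G k) bd × IsAdim (G k) ad × k ≤ a * bd × bd ≤ b * k × 2 ^ k ≤ ad ^ c
theorem5p1 = gapGraph , 1 , 4 , 1 , λ k 1≤k →
  let bd , isBdim     = bdim-exists (gapGraph k)
      ad , isAdim     = adim-exists (gapGraph k)
      k≤bd , bd≤4k    = bdim-bounds 1≤k isBdim
  in bd , ad , isBdim , isAdim ,
     subst (k ≤_) (sym (*-identityˡ bd)) k≤bd , bd≤4k ,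
     subst (2 ^ k ≤_) (sym (^-identityʳ ad)) (adim-bound 1≤k isAdim)
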